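{- Strong confluence is not first-order definable: the properties $\mathrm{SC}$ and $\neg\mathrm{SC}$ of abstract rewrite systems are not generalised first-order properties.
   Context: An ARS is a pair $(A,\to)$, $A$ non-empty, ${\to}\subseteq A\times A$; $\twoheadrightarrow$ is the reflexive transitive closure and $\to^{\equiv}$ is $\to$ union identity. SC (strong confluence): whenever $a\to x$ and $a\to y$, there is $z$ with $x\to^{\equiv}z$ and $y\twoheadrightarrow z$. $\neg\mathrm{SC}$ is the property of not being strongly confluent. A property $P$ is a generalised first-order property if there is a set $\Phi$ of sentences of first-order logic with equality and a binary predicate symbol $\to$ (interpreted as the one-step relation) such that for every ARS $\mathcal{A}$, $\mathcal{A}$ has $P$ iff $\mathcal{A}\models\Phi$. -}

module Defs where

open import Data.Nat using (ℕ; suc)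
open import Data.Fin using (Fin; zero; suc)
open import Data.Product using (Σ; _×_; _,_)
open import Data.Sum using (_⊎_)
open import Data.Empty using (⊥)
open import Relation.Nullary using (¬_)
open import Relation.Binary.PropositionalEquality using (_≡_)
open import Relation.Binary.Construct.Closure.ReflexiveTransitive using (Star)

record ARS : Set₁ where
  field
    Carrier : Set
    _⟶_     : Carrier → Carrier → Set
    point   : Carrier          -- witnesses non-emptiness

module _ (𝒜 : ARS) where
  open ARS 𝒜

  _↠_ : Carrier → Carrier → Set
  _↠_ = Star _⟶_

  _⟶≡_ : Carrier → Carrier → Set
  x ⟶≡ y = (x ⟶ y) ⊎ (x ≡ y)

  SC : Set
  SC = ∀ a x y → a ⟶ x → a ⟶ y → Σ Carrier λ z → (x ⟶≡ z) × (y ↠ z)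

-- Formulas with n free variables (de Bruijn indices in Fin n).
-- Connectives ⊥, ⇒, ∧, ∀ form a (classically) complete set;
-- ¬, ∨, ∃, ↔ are definable from them.

data Formula : ℕ → Set where
  _≐_  : ∀ {n} → Fin n → Fin n → Formula n
  _⇝_  : ∀ {n} → Fin n → Fin n → Formula n
  ⊥'   : ∀ {n} → Formula n
  _⇒_  : ∀ {n} → Formula n → Formula n → Formula n
  _∧'_ : ∀ {n} → Formula n → Formula n → Formula n
  ∀'   : ∀ {n} → Formula (suc n) → Formula n

Sentence : Set
Sentence = Formula 0

-- Atomic facts are read through
-- double negation, which makes every formula's truth value ¬¬-stable,
-- so this is the standard classical semantics rendered constructively.

extend : ∀ {n} {A : Set} → A → (Fin n → A) → Fin (suc n) → A
extend a ρ zero    = a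
extend a ρ (suc i) = ρ i

Sat : (𝒜 : ARS) → ∀ {n} → Formula n → (Fin n → ARS.Carrier 𝒜) → Set
Sat 𝒜 (i ≐ j)  ρ = ¬ ¬ (ρ i ≡ ρ j)
Sat 𝒜 (i ⇝ j)  ρ = ¬ ¬ (ARS._⟶_ 𝒜 (ρ i) (ρ j))
Sat 𝒜 ⊥'       ρ = ⊥
Sat 𝒜 (φ ⇒ ψ)  ρ = Sat 𝒜 φ ρ → Sat 𝒜 ψ ρ
Sat 𝒜 (φ ∧' ψ) ρ = Sat 𝒜 φ ρ × Sat 𝒜 ψ ρ
Sat 𝒜 (∀' φ)   ρ = ∀ a → Sat 𝒜 φ (extend a ρ)

noVars : {A : Set} → Fin 0 → A
noVars ()

_⊨_ : ARS → Sentence → Set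
𝒜 ⊨ φ = Sat 𝒜 φ noVars

_⊨ˢ_ : ARS → (Sentence → Set) → Set
𝒜 ⊨ˢ Φ = ∀ φ → Φ φ → 𝒜 ⊨ φ

GenFO : (ARS → Set) → Set₁
GenFO P = Σ (Sentence → Set) λ Φ →
  ∀ (𝒜 : ARS) → (P 𝒜 → 𝒜 ⊨ˢ Φ) × (𝒜 ⊨ˢ Φ → P 𝒜)

-- Let the group G = ℤ × ℤ/2 act on a set X, with s = (1, 0) and m = (0, 1).  Turn X into an ARS
-- whose base nodes follow s, and add above every x a peak with edges to x and to m·x.  The peak
-- is strongly confluent exactly when x and m·x can reach each other along s.  On a cycle of
-- length 2N, with m acting as s^N, they can; on the free orbit G, they cannot.  Now compare
-- infinitely many copies of every such cycle with the same G-set plus one free orbit: a sentence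
-- of quantifier depth d only sees G-relations of length at most 2^d, and cycles with N > 2^d
-- look free at that scale, so an Ehrenfeucht–Fraïssé argument shows that the two ARSs satisfy
-- the same sentences, although only the first is strongly confluent.
module Submission where

open import Defs
import Algebra.Properties.CommutativeSemigroup as CommutativeSemigroup
open import Axiom.UniquenessOfIdentityProofs using (module Decidable⇒UIP)
open import Data.Bool.Base using (Bool; true; false; _xor_)
import Data.Bool.Properties as Bool
open import Data.Empty using (⊥; ⊥-elim)
open import Data.Fin.Base using (Fin; zero; suc; toℕ)
import Data.Fin.Properties as Fin
import Data.Integer.Base as ℤ
open ℤ using (ℤ; +_; -[1+_]; ∣_∣)
import Data.Integer.Properties as ℤₚ
open import Data.List.Base using (List; []; _∷_)
open import Data.List.Membership.Propositional using (_∈_; find; lose)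
open import Data.List.Relation.Unary.Any using (Any; here; there; any?)
open import Data.Nat.Base using (ℕ; zero; suc; _+_; _*_; _^_; _∸_; _⊔_; _≤_; _<_; z≤n; s≤s)
open import Data.Nat.DivMod
  using (_%_; _/_; _mod_; m≡m%n+[m/n]*n; %-distribˡ-+; m%n%n≡m%n; [m+n]%n≡m%n; m<n⇒m%n≡m)
open import Data.Nat.Divisibility using (divides; ∣⇒≤)
import Data.Nat.Properties as ℕₚ
open import Data.Product.Base using (Σ; ∃; _×_; _,_; proj₁; proj₂)
import Data.Product.Properties as Product
open import Data.Sum.Base using (_⊎_; inj₁; inj₂)
import Data.Sum.Base as Sum
import Data.Sum.Properties as Sum
open import Data.Product.Function.NonDependent.Propositional using (_×-⇔_)
open import Data.Sum.Function.Propositional using (_⊎-⇔_)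
open import Function.Base using (_∘_)
open import Function.Bundles using (_⇔_; mk⇔; Equivalence)
open import Function.Construct.Identity using (⇔-id)
open import Function.Properties.Inverse using (↔⇒⇔)
open import Function.Properties.Equivalence using () renaming (trans to ⇔-trans; sym to ⇔-sym)
open import Function.Related.TypeIsomorphisms using (→-cong-⇔)
open import Relation.Binary.Construct.Closure.ReflexiveTransitive
  using (Star; _◅_; _◅◅_) renaming (ε to ε⋆)
open import Relation.Binary.Definitions using (DecidableEquality)
open import Relation.Binary.PropositionalEquality
open import Relation.Nullary using (¬_; Dec; yes; no)
open import Relation.Nullary.Decidable using (map′)
open import Relation.Unary using (Decidable)
open ≡-Reasoning

-- The group G = ℤ × ℤ/2

G : Set
G = ℤ × Bool

infixl 7 _·_
_·_ : G → G → G
(a , c) · (b , d) = a ℤ.+ b , c xor d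

ε : G
ε = + 0 , false

infix 8 _⁻¹
_⁻¹ : G → G
(a , c) ⁻¹ = ℤ.- a , c

s m : G
s = + 1 , false
m = + 0 , true

‖_‖ : G → ℕ
‖ a , _ ‖ = ∣ a ∣

·-identityˡ : ∀ g → ε · g ≡ g
·-identityˡ (a , c) = cong (_, c) (ℤₚ.+-identityˡ a)

·-identityʳ : ∀ g → g · ε ≡ g
·-identityʳ (a , c) = cong₂ _,_ (ℤₚ.+-identityʳ a) (Bool.xor-identityʳ c)

·-assoc : ∀ g h k → g · h · k ≡ g · (h · k)
·-assoc (a , c) (b , d) (e , f) = cong₂ _,_ (ℤₚ.+-assoc a b e) (Bool.xor-assoc c d f)

·-comm : ∀ g h → g · h ≡ h · g
·-comm (a , c) (b , d) = cong₂ _,_ (ℤₚ.+-comm a b) (Bool.xor-comm c d)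

⁻¹-inverseˡ : ∀ g → g ⁻¹ · g ≡ ε
⁻¹-inverseˡ (a , c) = cong₂ _,_ (ℤₚ.+-inverseˡ a) (Bool.xor-same c)

⁻¹-inverseʳ : ∀ g → g · g ⁻¹ ≡ ε
⁻¹-inverseʳ g = trans (·-comm g (g ⁻¹)) (⁻¹-inverseˡ g)

·-cancelˡ : ∀ g h → g · (g ⁻¹ · h) ≡ h
·-cancelˡ g h = begin
  g · (g ⁻¹ · h) ≡⟨ ·-assoc g (g ⁻¹) h ⟨
  g · g ⁻¹ · h   ≡⟨ cong (_· h) (⁻¹-inverseʳ g) ⟩
  ε · h          ≡⟨ ·-identityˡ h ⟩
  h              ∎

·-fixed⇒ε : ∀ g h → g · h ≡ h → g ≡ ε
·-fixed⇒ε g h gh≡h = begin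
  g               ≡⟨ ·-identityʳ g ⟨
  g · ε           ≡⟨ cong (g ·_) (⁻¹-inverseʳ h) ⟨
  g · (h · h ⁻¹)  ≡⟨ ·-assoc g h (h ⁻¹) ⟨
  g · h · h ⁻¹    ≡⟨ cong (_· h ⁻¹) gh≡h ⟩
  h · h ⁻¹        ≡⟨ ⁻¹-inverseʳ h ⟩
  ε               ∎

‖⁻¹‖≤ : ∀ {r} g → ‖ g ‖ ≤ r → ‖ g ⁻¹ ‖ ≤ r
‖⁻¹‖≤ (a , _) = subst (_≤ _) (sym (ℤₚ.∣-i∣≡∣i∣ a))

‖·‖≤2* : ∀ {r} g h → ‖ g ‖ ≤ r → ‖ h ‖ ≤ r → ‖ g · h ‖ ≤ 2 * r
‖·‖≤2* (a , _) (b , _) a≤r b≤r =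
  ℕₚ.≤-trans (ℤₚ.∣i+j∣≤∣i∣+∣j∣ a b) (ℕₚ.+-mono-≤ a≤r (ℕₚ.m≤n⇒m≤n+o 0 b≤r))

sphere : ℕ → List G
sphere k = (+ k , false) ∷ (+ k , true) ∷ (ℤ.- + k , false) ∷ (ℤ.- + k , true) ∷ []

∈-sphere⇒‖‖≡ : ∀ {g k} → g ∈ sphere k → ‖ g ‖ ≡ k
∈-sphere⇒‖‖≡         (here refl)                         = refl
∈-sphere⇒‖‖≡         (there (here refl))                 = refl
∈-sphere⇒‖‖≡ {k = k} (there (there (here refl)))         = ℤₚ.∣-i∣≡∣i∣ (+ k)
∈-sphere⇒‖‖≡ {k = k} (there (there (there (here refl)))) = ℤₚ.∣-i∣≡∣i∣ (+ k)

∈-sphere : ∀ g → g ∈ sphere ‖ g ‖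
∈-sphere (+ k , false)      = here refl
∈-sphere (+ k , true)       = there (here refl)
∈-sphere (-[1+ k ] , false) = there (there (here refl))
∈-sphere (-[1+ k ] , true)  = there (there (there (here refl)))

ball? : ∀ {P : G → Set} → Decidable P → ∀ r → Dec (∃ λ g → ‖ g ‖ ≤ r × P g)
ball? {P} P? r = map′ found located (ℕₚ.anyUpTo? (λ k → any? P? (sphere k)) (suc r))
  where
  found : ∃ (λ k → k < suc r × Any P (sphere k)) → ∃ λ g → ‖ g ‖ ≤ r × P g
  found (k , s≤s k≤r , onSphere) with find onSphere
  ... | g , g∈ , Pg = g , subst (_≤ r) (sym (∈-sphere⇒‖‖≡ g∈)) k≤r , Pg

  located : ∃ (λ g → ‖ g ‖ ≤ r × P g) → ∃ λ k → k < suc r × Any P (sphere k)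
  located (g , g≤r , Pg) = ‖ g ‖ , s≤s g≤r , lose (∈-sphere g) Pg

record GSet : Set₁ where
  infixr 6 _▷_
  field
    Carrier    : Set
    _▷_        : G → Carrier → Carrier
    ▷-identity : ∀ x → ε ▷ x ≡ x
    ▷-assoc    : ∀ g h x → (g · h) ▷ x ≡ g ▷ h ▷ x
    _≟_        : DecidableEquality Carrier

module GSetProperties (S : GSet) where
  open GSet S

  ▷-inverseˡ : ∀ g x → g ⁻¹ ▷ g ▷ x ≡ x
  ▷-inverseˡ g x = begin
    g ⁻¹ ▷ g ▷ x    ≡⟨ ▷-assoc (g ⁻¹) g x ⟨
    (g ⁻¹ · g) ▷ x  ≡⟨ cong (_▷ x) (⁻¹-inverseˡ g) ⟩
    ε ▷ x           ≡⟨ ▷-identity x ⟩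
    x               ∎

  ▷-transpose : ∀ {g x y} → g ▷ x ≡ y → g ⁻¹ ▷ y ≡ x
  ▷-transpose {g} {x} refl = ▷-inverseˡ g x

  ▷-injective : ∀ g {x y} → g ▷ x ≡ g ▷ y → x ≡ y
  ▷-injective g {x} gx≡gy = trans (sym (▷-inverseˡ g x)) (▷-transpose (sym gx≡gy))

  ▷-comm : ∀ g h x → g ▷ h ▷ x ≡ h ▷ g ▷ x
  ▷-comm g h x = trans (sym (▷-assoc g h x)) (trans (cong (_▷ x) (·-comm g h)) (▷-assoc h g x))

  ▷-▷-⇔ : ∀ g h x y → (g ▷ h ▷ x ≡ y) ⇔ ((g · h) ▷ x ≡ y)
  ▷-▷-⇔ g h x y = mk⇔ (trans (▷-assoc g h x)) (trans (sym (▷-assoc g h x)))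

  ▷-≡-▷-⇔ : ∀ g h x y → (g ▷ x ≡ h ▷ y) ⇔ ((h ⁻¹ · g) ▷ x ≡ y)
  ▷-≡-▷-⇔ g h x y = mk⇔
    (λ gx≡hy → trans (▷-assoc (h ⁻¹) g x) (▷-transpose (sym gx≡hy)))
    (λ e → begin
      g ▷ x                 ≡⟨ cong (_▷ x) (·-cancelˡ h g) ⟨
      (h · (h ⁻¹ · g)) ▷ x  ≡⟨ ▷-assoc h (h ⁻¹ · g) x ⟩
      h ▷ (h ⁻¹ · g) ▷ x    ≡⟨ cong (h ▷_) e ⟩
      h ▷ y                 ∎)

  ▷-fixed-⇔ : ∀ g h x → (g ▷ h ▷ x ≡ h ▷ x) ⇔ (g ▷ x ≡ x)
  ▷-fixed-⇔ g h x = mk⇔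
    (λ fixed → ▷-injective h (trans (sym (▷-comm g h x)) fixed))
    (λ fixed → trans (▷-comm g h x) (cong (h ▷_) fixed))

regular : GSet
regular = record
  { Carrier    = G
  ; _▷_        = _·_
  ; ▷-identity = ·-identityˡ
  ; ▷-assoc    = ·-assoc
  ; _≟_        = Product.≡-dec ℤₚ._≟_ Bool._≟_
  }

infixr 4 _⊎ᴳ_
_⊎ᴳ_ : GSet → GSet → GSet
S ⊎ᴳ T = record
  { Carrier    = S.Carrier ⊎ T.Carrier
  ; _▷_        = λ g → Sum.map (g S.▷_) (g T.▷_)
  ; ▷-identity = λ { (inj₁ x) → cong inj₁ (S.▷-identity x)
                   ; (inj₂ y) → cong inj₂ (T.▷-identity y) }
  ; ▷-assoc    = λ { g h (inj₁ x) → cong inj₁ (S.▷-assoc g h x)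
                   ; g h (inj₂ y) → cong inj₂ (T.▷-assoc g h y) }
  ; _≟_        = Sum.≡-dec S._≟_ T._≟_
  }
  where
  module S = GSet S
  module T = GSet T

⨆ : (I : Set) → DecidableEquality I → (I → GSet) → GSet
⨆ I _≟ᴵ_ S = record
  { Carrier    = Σ I (GSet.Carrier ∘ S)
  ; _▷_        = λ { g (i , x) → i , GSet._▷_ (S i) g x }
  ; ▷-identity = λ { (i , x) → cong (i ,_) (GSet.▷-identity (S i) x) }
  ; ▷-assoc    = λ { g h (i , x) → cong (i ,_) (GSet.▷-assoc (S i) g h x) }
  ; _≟_        = Product.≡-dec _≟ᴵ_ (GSet._≟_ (S _))
  }

⨆-fixed-⇔ : ∀ {I} (_≟ᴵ_ : DecidableEquality I) S {i} g x →
            (GSet._▷_ (⨆ I _≟ᴵ_ S) g (i , x) ≡ (i , x)) ⇔ (GSet._▷_ (S i) g x ≡ x)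
⨆-fixed-⇔ _≟ᴵ_ S {i} g x =
  mk⇔ (Product.,-injectiveʳ-UIP (Decidable⇒UIP.≡-irrelevant _≟ᴵ_)) (cong (i ,_))

-- Back and forth between G-sets

module Similarity (S T : GSet) where
  open GSet S using () renaming (Carrier to X; _▷_ to _▷ˢ_; _≟_ to _≟ˢ_)
  open GSet T using () renaming (Carrier to Y; _▷_ to _▷ᵗ_)
  private
    module S = GSetProperties S
    module T = GSetProperties T

  Similar : ∀ {n} → ℕ → (Fin n → X) → (Fin n → Y) → Set
  Similar r α β = ∀ i j g → ‖ g ‖ ≤ r → (g ▷ˢ α i ≡ α j) ⇔ (g ▷ᵗ β i ≡ β j)

  FreshPartners : Set
  FreshPartners = ∀ r (x : X) {n} (β : Fin n → Y) → ∃ λ y →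
    (∀ i g → ‖ g ‖ ≤ r → g ▷ᵗ β i ≢ y) × (∀ g → ‖ g ‖ ≤ r → (g ▷ˢ x ≡ x) ⇔ (g ▷ᵗ y ≡ y))

  Similar⇒≡-⇔ : ∀ {n r} {α : Fin n → X} {β} → Similar r α β → ∀ i j → (α i ≡ α j) ⇔ (β i ≡ β j)
  Similar⇒≡-⇔ {α = α} {β} sim i j = ⇔-trans
    (mk⇔ (trans (GSet.▷-identity S (α i))) (trans (sym (GSet.▷-identity S (α i)))))
    (⇔-trans (sim i j ε z≤n)
    (mk⇔ (trans (sym (GSet.▷-identity T (β i)))) (trans (GSet.▷-identity T (β i)))))

  Similar-halve : ∀ {n r} {α : Fin n → X} {β} → Similar (2 * r) α β → Similar r α β
  Similar-halve {r = r} sim i j g g≤r = sim i j g (ℕₚ.≤-trans g≤r (ℕₚ.m≤n*m r 2))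

  near? : ∀ {n} r (α : Fin n → X) x → Dec (∃ λ i → ∃ λ g → ‖ g ‖ ≤ r × g ▷ˢ α i ≡ x)
  near? r α x = Fin.any? λ i → ball? (λ g → (g ▷ˢ α i) ≟ˢ x) r

  -- A point within r of some α i is matched by the same displacement of β i, and then its
  -- relations to the old points are relations of length at most 2r between those.  A point far
  -- from all α i gets a fresh partner.
  forth : FreshPartners → ∀ {n} r {α : Fin n → X} {β} → Similar (2 * r) α β →
          ∀ x → ∃ λ y → Similar r (extend x α) (extend y β)
  forth fresh r {α} {β} sim x with near? r α x
  ... | yes (i , h , h≤r , refl) = h ▷ᵗ β i , near
    where
    near : Similar r (extend (h ▷ˢ α i) α) (extend (h ▷ᵗ β i) β)
    near zero zero g g≤r = ⇔-trans (S.▷-fixed-⇔ g h (α i))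
      (⇔-trans (Similar-halve sim i i g g≤r) (⇔-sym (T.▷-fixed-⇔ g h (β i))))
    near zero (suc j) g g≤r = ⇔-trans (S.▷-▷-⇔ g h (α i) (α j))
      (⇔-trans (sim i j (g · h) (‖·‖≤2* g h g≤r h≤r)) (⇔-sym (T.▷-▷-⇔ g h (β i) (β j))))
    near (suc j) zero g g≤r = ⇔-trans (S.▷-≡-▷-⇔ g h (α j) (α i))
      (⇔-trans (sim j i (h ⁻¹ · g) (‖·‖≤2* (h ⁻¹) g (‖⁻¹‖≤ h h≤r) g≤r))
               (⇔-sym (T.▷-≡-▷-⇔ g h (β j) (β i))))
    near (suc j) (suc k) = Similar-halve sim j k
  ... | no far with fresh r x β
  ...   | y , far′ , sameStabilizer = y , apart
    where
    apart : Similar r (extend x α) (extend y β)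
    apart zero zero g g≤r = sameStabilizer g g≤r
    apart zero (suc j) g g≤r = mk⇔
      (λ gx≡αj → ⊥-elim (far (j , g ⁻¹ , ‖⁻¹‖≤ g g≤r , S.▷-transpose gx≡αj)))
      (λ gy≡βj → ⊥-elim (far′ j (g ⁻¹) (‖⁻¹‖≤ g g≤r) (T.▷-transpose gy≡βj)))
    apart (suc j) zero g g≤r =
      mk⇔ (λ gαj≡x → ⊥-elim (far (j , g , g≤r , gαj≡x))) (⊥-elim ∘ far′ j g g≤r)
    apart (suc j) (suc k) = Similar-halve sim j k

Similar-sym : ∀ S T {n r} {α : Fin n → GSet.Carrier S} {β} →
              Similarity.Similar S T r α β → Similarity.Similar T S r β α
Similar-sym S T sim i j g g≤r = ⇔-sym (sim i j g g≤r)

back : ∀ S T → Similarity.FreshPartners T S → ∀ {n} r {α : Fin n → GSet.Carrier S} {β} →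
       Similarity.Similar S T (2 * r) α β →
       ∀ y → ∃ λ x → Similarity.Similar S T r (extend x α) (extend y β)
back S T fresh r sim y with Similarity.forth T S fresh r (Similar-sym S T sim) y
... | x , sim′ = x , Similar-sym T S sim′

-- The rewrite system of a G-set

data Layer : Set where
  base peak : Layer

module RewriteSystem (S : GSet) where
  open GSet S
  open GSetProperties S

  Node : Set
  Node = Layer × Carrier

  -- The ⊥ clause comes first so that Step t peak x y reduces for every t.
  Step : Layer → Layer → Carrier → Carrier → Set
  Step _    peak _ _ = ⊥
  Step base base x y = s ▷ x ≡ y
  Step peak base x y = x ≡ y ⊎ m ▷ x ≡ y

  infix 4 _⟶_ _⟶*_
  _⟶_ : Node → Node → Set
  (t , x) ⟶ (u , y) = Step t u x y

  _⟶*_ : Node → Node → Set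
  _⟶*_ = Star _⟶_

  𝔸 : Carrier → ARS
  𝔸 x₀ = record { Carrier = Node ; _⟶_ = _⟶_ ; point = base , x₀ }

  ⟶*-s-power : ∀ k x → (base , x) ⟶* (base , (+ k , false) ▷ x)
  ⟶*-s-power zero    x = subst (λ y → (base , x) ⟶* (base , y)) (sym (▷-identity x)) ε⋆
  ⟶*-s-power (suc k) x = ⟶*-s-power k x ◅◅ (sym (▷-assoc s (+ k , false) x) ◅ ε⋆)

  ⟶*-from-base : ∀ {x w} → (base , x) ⟶* w → ∃ λ a → w ≡ (base , (a , false) ▷ x)
  ⟶*-from-base {x} ε⋆ = + 0 , cong (base ,_) (sym (▷-identity x))
  ⟶*-from-base {x} (_◅_ {j = base , _} refl rest) with ⟶*-from-base rest
  ... | a , refl = a ℤ.+ + 1 , cong (base ,_) (sym (▷-assoc (a , false) s x))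

  m-reachable⇒SC : (∀ x → (base , x) ⟶* (base , m ▷ x)) → ∀ x₀ → SC (𝔸 x₀)
  m-reachable⇒SC reach _ (base , a) (base , _) (base , _) refl refl = (base , s ▷ a) , inj₂ refl , ε⋆
  m-reachable⇒SC reach _ (peak , a) (base , x) (base , y) a→x a→y =
    (base , x) , inj₂ refl , return a→x a→y
    where
    return : a ≡ x ⊎ m ▷ a ≡ x → a ≡ y ⊎ m ▷ a ≡ y → (base , y) ⟶* (base , x)
    return (inj₁ refl) (inj₁ refl) = ε⋆
    return (inj₁ refl) (inj₂ refl) =
      subst (λ z → (base , m ▷ a) ⟶* (base , z)) m▷m▷a≡a (reach (m ▷ a))
      where m▷m▷a≡a = trans (sym (▷-assoc m m a)) (▷-identity a)
    return (inj₂ refl) (inj₁ refl) = reach a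
    return (inj₂ refl) (inj₂ refl) = ε⋆

  m∉s-orbit⇒¬SC : ∀ x → (∀ a → (a , false) ▷ x ≢ m ▷ x) → ∀ x₀ → ¬ SC (𝔸 x₀)
  m∉s-orbit⇒¬SC x m∉orbit _ sc with sc (peak , x) (base , x) (base , m ▷ x) (inj₁ refl) (inj₂ refl)
  ... | z , x→≡z , mx⟶*z with ⟶*-from-base mx⟶*z
  ...   | a , refl with x→≡z
  ...     | inj₁ sx≡amx = m∉orbit (ℤ.- a ℤ.+ + 1)
                            (trans (▷-assoc ((a , false) ⁻¹) s x) (▷-transpose (sym sx≡amx)))
  ...     | inj₂ x≡amx  = m∉orbit (ℤ.- a) (▷-transpose (sym (Product.,-injectiveʳ x≡amx)))

-- Transfer of first-order sentences

GenFO-transfer : ∀ {P 𝒜 ℬ} → GenFO P → (∀ φ → 𝒜 ⊨ φ → ℬ ⊨ φ) → P 𝒜 → P ℬ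
GenFO-transfer (Φ , defines) 𝒜⇒ℬ P𝒜 =
  proj₂ (defines _) (λ φ φ∈Φ → 𝒜⇒ℬ φ (proj₁ (defines _) P𝒜 φ φ∈Φ))

quantifierDepth : ∀ {n} → Formula n → ℕ
quantifierDepth (_ ≐ _)  = 0
quantifierDepth (_ ⇝ _)  = 0
quantifierDepth ⊥'       = 0
quantifierDepth (φ ⇒ ψ)  = quantifierDepth φ ⊔ quantifierDepth ψ
quantifierDepth (φ ∧' ψ) = quantifierDepth φ ⊔ quantifierDepth ψ
quantifierDepth (∀' φ)   = suc (quantifierDepth φ)

pairs-≡-⇔ : ∀ {A B : Set} {p q : A × B} → (proj₁ p ≡ proj₁ q × proj₂ p ≡ proj₂ q) ⇔ (p ≡ q)
pairs-≡-⇔ = ↔⇒⇔ Product.×-≡,≡↔≡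

¬¬-cong : ∀ {A B : Set} → A ⇔ B → (¬ ¬ A) ⇔ (¬ ¬ B)
¬¬-cong A⇔B = →-cong-⇔ (→-cong-⇔ A⇔B (⇔-id _)) (⇔-id _)

module ElementaryEquivalence (S T : GSet)
    (freshᵗ : Similarity.FreshPartners S T) (freshˢ : Similarity.FreshPartners T S) where
  open GSet S using () renaming (Carrier to X; _▷_ to _▷ˢ_)
  open GSet T using () renaming (Carrier to Y; _▷_ to _▷ᵗ_)
  open Similarity S T using (Similar; Similar⇒≡-⇔; forth)
  module RS = RewriteSystem S
  module RT = RewriteSystem T

  NodesSimilar : ∀ {n} → ℕ → (Fin n → RS.Node) → (Fin n → RT.Node) → Set
  NodesSimilar r ρ σ = (∀ i → proj₁ (ρ i) ≡ proj₁ (σ i)) × Similar r (proj₂ ∘ ρ) (proj₂ ∘ σ)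

  private
    module _ {n : ℕ} {t : Layer} {ρ : Fin n → RS.Node} {σ : Fin n → RT.Node} {x : X} {y : Y} where
      -- the two sides agree definitionally once the indices are split
      regroup : ∀ {r} → Similar r (extend x (proj₂ ∘ ρ)) (extend y (proj₂ ∘ σ)) →
                Similar r (proj₂ ∘ extend (t , x) ρ) (proj₂ ∘ extend (t , y) σ)
      regroup sim zero    zero    = sim zero zero
      regroup sim zero    (suc j) = sim zero (suc j)
      regroup sim (suc i) zero    = sim (suc i) zero
      regroup sim (suc i) (suc j) = sim (suc i) (suc j)

      extend-layers : (∀ i → proj₁ (ρ i) ≡ proj₁ (σ i)) →
                      ∀ i → proj₁ (extend (t , x) ρ i) ≡ proj₁ (extend (t , y) σ i)
      extend-layers layers zero    = refl
      extend-layers layers (suc i) = layers i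

  extendˡ : ∀ {n} r {ρ : Fin n → RS.Node} {σ} → NodesSimilar (2 * r) ρ σ →
            ∀ a → ∃ λ b → NodesSimilar r (extend a ρ) (extend b σ)
  extendˡ r (layers , sim) (t , x) with forth freshᵗ r sim x
  ... | y , sim′ = (t , y) , extend-layers {x = x} {y = y} layers , regroup sim′

  extendʳ : ∀ {n} r {ρ : Fin n → RS.Node} {σ} → NodesSimilar (2 * r) ρ σ →
            ∀ b → ∃ λ a → NodesSimilar r (extend a ρ) (extend b σ)
  extendʳ r (layers , sim) (t , y) with back S T freshˢ r sim y
  ... | x , sim′ = (t , x) , extend-layers {x = x} {y = y} layers , regroup sim′

  Step-cong : ∀ t u {x x′ y y′} → (x ≡ x′) ⇔ (y ≡ y′) → (s ▷ˢ x ≡ x′) ⇔ (s ▷ᵗ y ≡ y′) →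
              (m ▷ˢ x ≡ x′) ⇔ (m ▷ᵗ y ≡ y′) → RS.Step t u x x′ ⇔ RT.Step t u y y′
  Step-cong _    peak _  _  _  = ⇔-id ⊥
  Step-cong base base _  ≡s _  = ≡s
  Step-cong peak base ≡ε _  ≡m = ≡ε ⊎-⇔ ≡m

  Sat-invariant : ∀ {n} d (φ : Formula n) {ρ σ} x₀ y₀ → quantifierDepth φ ≤ d →
                  NodesSimilar (2 ^ d) ρ σ → Sat (RS.𝔸 x₀) φ ρ ⇔ Sat (RT.𝔸 y₀) φ σ
  Sat-invariant d (i ≐ j) {ρ} {σ} _ _ _ (layers , sim) = ¬¬-cong (⇔-trans
    (⇔-sym pairs-≡-⇔)
    (⇔-trans (layers-⇔ ×-⇔ Similar⇒≡-⇔ sim i j) pairs-≡-⇔))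
    where
    layers-⇔ : (proj₁ (ρ i) ≡ proj₁ (ρ j)) ⇔ (proj₁ (σ i) ≡ proj₁ (σ j))
    layers-⇔ rewrite layers i | layers j = ⇔-id _
  Sat-invariant d (i ⇝ j) {ρ} {σ} _ _ _ (layers , sim)
    rewrite layers i | layers j = ¬¬-cong (Step-cong (proj₁ (σ i)) (proj₁ (σ j))
      (Similar⇒≡-⇔ sim i j) (sim i j s (ℕₚ.m^n>0 2 d)) (sim i j m z≤n))
  Sat-invariant d ⊥' _ _ _ _ = ⇔-id ⊥
  Sat-invariant d (φ ⇒ ψ) x₀ y₀ depth≤d sim = →-cong-⇔
    (Sat-invariant d φ x₀ y₀ (ℕₚ.m⊔n≤o⇒m≤o _ _ depth≤d) sim)
    (Sat-invariant d ψ x₀ y₀ (ℕₚ.m⊔n≤o⇒n≤o _ _ depth≤d) sim)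
  Sat-invariant d (φ ∧' ψ) x₀ y₀ depth≤d sim =
    Sat-invariant d φ x₀ y₀ (ℕₚ.m⊔n≤o⇒m≤o _ _ depth≤d) sim ×-⇔
    Sat-invariant d ψ x₀ y₀ (ℕₚ.m⊔n≤o⇒n≤o _ _ depth≤d) sim
  Sat-invariant (suc d) (∀' φ) x₀ y₀ (s≤s depth≤d) sim = mk⇔
    (λ holdsˢ b → let a , sim′ = extendʳ (2 ^ d) sim b in
      Equivalence.to (Sat-invariant d φ x₀ y₀ depth≤d sim′) (holdsˢ a))
    (λ holdsᵗ a → let b , sim′ = extendˡ (2 ^ d) sim a in
      Equivalence.from (Sat-invariant d φ x₀ y₀ depth≤d sim′) (holdsᵗ b))

  ⊨-invariant : ∀ x₀ y₀ φ → (RS.𝔸 x₀ ⊨ φ) ⇔ (RT.𝔸 y₀ ⊨ φ)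
  ⊨-invariant x₀ y₀ φ = Sat-invariant (quantifierDepth φ) φ x₀ y₀ ℕₚ.≤-refl ((λ ()) , λ ())

-- Cycles of length 2N on which m acts as s^N

module Powers {C : Set} (next prev : C → C)
    (prev-next : ∀ x → prev (next x) ≡ x) (next-prev : ∀ x → next (prev x) ≡ x) where
  open import Function.Endo.Propositional C using () renaming (_^_ to _^ᶠ_)

  pow : ℤ → C → C
  pow (+ k)    = next ^ᶠ k
  pow -[1+ k ] = prev ^ᶠ suc k

  pow-suc : ∀ z x → pow (+ 1 ℤ.+ z) x ≡ next (pow z x)
  pow-suc (+ k)        x = refl
  pow-suc -[1+ zero ]  x = sym (next-prev x)
  pow-suc -[1+ suc k ] x = sym (next-prev _)

  pow-pred : ∀ z x → pow (-[1+ 0 ] ℤ.+ z) x ≡ prev (pow z x)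
  pow-pred (+ zero)  x = refl
  pow-pred (+ suc k) x = sym (prev-next _)
  pow-pred -[1+ k ]  x = refl

  pow-+ : ∀ z w x → pow (z ℤ.+ w) x ≡ pow z (pow w x)
  pow-+ (+ zero)     w x = cong (λ v → pow v x) (ℤₚ.+-identityˡ w)
  pow-+ (+ suc k)    w x = begin
    pow (+ suc k ℤ.+ w) x         ≡⟨ cong (λ v → pow v x) (ℤₚ.+-assoc (+ 1) (+ k) w) ⟩
    pow (+ 1 ℤ.+ (+ k ℤ.+ w)) x   ≡⟨ pow-suc (+ k ℤ.+ w) x ⟩
    next (pow (+ k ℤ.+ w) x)      ≡⟨ cong next (pow-+ (+ k) w x) ⟩
    next (pow (+ k) (pow w x))    ∎
  pow-+ -[1+ zero ]  w x = pow-pred w x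
  pow-+ -[1+ suc k ] w x = begin
    pow (-[1+ suc k ] ℤ.+ w) x         ≡⟨ cong (λ v → pow v x) (ℤₚ.+-assoc -[1+ 0 ] -[1+ k ] w) ⟩
    pow (-[1+ 0 ] ℤ.+ (-[1+ k ] ℤ.+ w)) x ≡⟨ pow-pred (-[1+ k ] ℤ.+ w) x ⟩
    prev (pow (-[1+ k ] ℤ.+ w) x)      ≡⟨ cong prev (pow-+ -[1+ k ] w x) ⟩
    prev (pow -[1+ k ] (pow w x))      ∎

  pow-fixed-neg : ∀ z x → pow z x ≡ x → pow (ℤ.- z) x ≡ x
  pow-fixed-neg z x fixed = begin
    pow (ℤ.- z) x              ≡⟨ cong (pow (ℤ.- z)) fixed ⟨
    pow (ℤ.- z) (pow z x)      ≡⟨ pow-+ (ℤ.- z) z x ⟨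
    pow (ℤ.- z ℤ.+ z) x        ≡⟨ cong (λ v → pow v x) (ℤₚ.+-inverseˡ z) ⟩
    x                          ∎

module Cycle (n : ℕ) where
  N L : ℕ
  N = suc n
  L = N + N

  rot : ℕ → Fin L → Fin L
  rot k u = (toℕ u + k) mod L

  toℕ-rot : ∀ k u → toℕ (rot k u) ≡ (toℕ u + k) % L
  toℕ-rot k u = Fin.toℕ-fromℕ< _

  rot-+ : ∀ j k u → rot (j + k) u ≡ rot j (rot k u)
  rot-+ j k u = Fin.toℕ-injective (begin
    toℕ (rot (j + k) u)               ≡⟨ toℕ-rot (j + k) u ⟩
    (toℕ u + (j + k)) % L             ≡⟨ cong (λ i → (toℕ u + i) % L) (ℕₚ.+-comm j k) ⟩
    (toℕ u + (k + j)) % L             ≡⟨ cong (_% L) (ℕₚ.+-assoc (toℕ u) k j) ⟨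
    (toℕ u + k + j) % L               ≡⟨ %-distribˡ-+ (toℕ u + k) j L ⟩
    ((toℕ u + k) % L + j % L) % L     ≡⟨ cong (λ v → (v + j % L) % L) (m%n%n≡m%n (toℕ u + k) L) ⟨
    ((toℕ u + k) % L % L + j % L) % L ≡⟨ %-distribˡ-+ ((toℕ u + k) % L) j L ⟨
    ((toℕ u + k) % L + j) % L         ≡⟨ cong (λ v → (v + j) % L) (toℕ-rot k u) ⟨
    (toℕ (rot k u) + j) % L           ≡⟨ toℕ-rot j (rot k u) ⟨
    toℕ (rot j (rot k u))             ∎)

  rot-zero : ∀ u → rot 0 u ≡ u
  rot-zero u = Fin.toℕ-injective (begin
    toℕ (rot 0 u)      ≡⟨ toℕ-rot 0 u ⟩
    (toℕ u + 0) % L    ≡⟨ cong (_% L) (ℕₚ.+-identityʳ (toℕ u)) ⟩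
    toℕ u % L          ≡⟨ m<n⇒m%n≡m (Fin.toℕ<n u) ⟩
    toℕ u              ∎)

  rot-period : ∀ u → rot L u ≡ u
  rot-period u = Fin.toℕ-injective (begin
    toℕ (rot L u)      ≡⟨ toℕ-rot L u ⟩
    (toℕ u + L) % L    ≡⟨ [m+n]%n≡m%n (toℕ u) L ⟩
    toℕ u % L          ≡⟨ m<n⇒m%n≡m (Fin.toℕ<n u) ⟩
    toℕ u              ∎)

  rot-fixed⇒≡0 : ∀ {k} u → k < L → rot k u ≡ u → k ≡ 0
  rot-fixed⇒≡0 {zero}  u _   _     = refl
  rot-fixed⇒≡0 {suc k} u k<L fixed = ⊥-elim (ℕₚ.<⇒≱ k<L (∣⇒≤ (divides q k≡qL)))
    where
    q = (toℕ u + suc k) / L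
    k≡qL : suc k ≡ q * L
    k≡qL = ℕₚ.+-cancelˡ-≡ (toℕ u) _ _ (begin
      toℕ u + suc k                 ≡⟨ m≡m%n+[m/n]*n (toℕ u + suc k) L ⟩
      (toℕ u + suc k) % L + q * L   ≡⟨ cong (_+ q * L) (toℕ-rot (suc k) u) ⟨
      toℕ (rot (suc k) u) + q * L   ≡⟨ cong (λ v → toℕ v + q * L) fixed ⟩
      toℕ u + q * L                 ∎)

  open Powers (rot 1) (rot (L ∸ 1))
    (λ u → trans (sym (rot-+ (L ∸ 1) 1 u))
             (trans (cong (λ k → rot k u) (ℕₚ.+-comm (L ∸ 1) 1)) (rot-period u)))
    (λ u → trans (sym (rot-+ 1 (L ∸ 1) u)) (rot-period u))

  pow-rot : ∀ k u → pow (+ k) u ≡ rot k u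
  pow-rot zero    u = sym (rot-zero u)
  pow-rot (suc k) u = trans (cong (rot 1) (pow-rot k u)) (sym (rot-+ 1 k u))

  pow-period : ∀ u → pow (+ L) u ≡ u
  pow-period u = trans (pow-rot L u) (rot-period u)

  pow-fixed⇒≡0 : ∀ z u → ∣ z ∣ < L → pow z u ≡ u → z ≡ + 0
  pow-fixed⇒≡0 (+ k) u k<L fixed = cong +_ (rot-fixed⇒≡0 u k<L (trans (sym (pow-rot k u)) fixed))
  pow-fixed⇒≡0 -[1+ k ] u k<L fixed
    with rot-fixed⇒≡0 u k<L (trans (sym (pow-rot (suc k) u)) (pow-fixed-neg -[1+ k ] u fixed))
  ... | ()

  ⌜_⌝ : Bool → ℤ
  ⌜ false ⌝ = + 0
  ⌜ true  ⌝ = + N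

  infixr 6 _▷_
  _▷_ : G → Fin L → Fin L
  (a , c) ▷ u = pow (a ℤ.+ ⌜ c ⌝) u

  pow-⌜xor⌝ : ∀ z c d u → pow (z ℤ.+ ⌜ c xor d ⌝) u ≡ pow (z ℤ.+ (⌜ c ⌝ ℤ.+ ⌜ d ⌝)) u
  pow-⌜xor⌝ z false false u = refl
  pow-⌜xor⌝ z false true  u = refl
  pow-⌜xor⌝ z true  false u = cong (λ w → pow (z ℤ.+ w) u) (sym (ℤₚ.+-identityʳ (+ N)))
  pow-⌜xor⌝ z true  true  u = begin
    pow (z ℤ.+ + 0) u      ≡⟨ cong (λ w → pow w u) (ℤₚ.+-identityʳ z) ⟩
    pow z u                ≡⟨ cong (pow z) (pow-period u) ⟨
    pow z (pow (+ L) u)    ≡⟨ pow-+ z (+ L) u ⟨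
    pow (z ℤ.+ + L) u      ∎

  ▷-assoc : ∀ g h u → (g · h) ▷ u ≡ g ▷ h ▷ u
  ▷-assoc (a , c) (b , d) u = begin
    pow (a ℤ.+ b ℤ.+ ⌜ c xor d ⌝) u           ≡⟨ pow-⌜xor⌝ (a ℤ.+ b) c d u ⟩
    pow (a ℤ.+ b ℤ.+ (⌜ c ⌝ ℤ.+ ⌜ d ⌝)) u     ≡⟨ cong (λ w → pow w u) (interchange a b ⌜ c ⌝ ⌜ d ⌝) ⟩
    pow (a ℤ.+ ⌜ c ⌝ ℤ.+ (b ℤ.+ ⌜ d ⌝)) u     ≡⟨ pow-+ (a ℤ.+ ⌜ c ⌝) (b ℤ.+ ⌜ d ⌝) u ⟩
    pow (a ℤ.+ ⌜ c ⌝) (pow (b ℤ.+ ⌜ d ⌝) u)   ∎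
    where open CommutativeSemigroup ℤₚ.+-commutativeSemigroup using (interchange)

  m▷≡s^N▷ : ∀ u → m ▷ u ≡ (+ N , false) ▷ u
  m▷≡s^N▷ u = cong (λ w → pow w u) (sym (ℤₚ.+-identityʳ (+ N)))

  stabilizer-trivial : ∀ g u → ‖ g ‖ ≤ n → g ▷ u ≡ u → g ≡ ε
  stabilizer-trivial (a , false) u a≤n fixed =
    cong (_, false) (trans (sym (ℤₚ.+-identityʳ a)) (pow-fixed⇒≡0 (a ℤ.+ + 0) u bound fixed))
    where
    bound : ∣ a ℤ.+ + 0 ∣ < L
    bound = subst (λ w → ∣ w ∣ < L) (sym (ℤₚ.+-identityʳ a)) (ℕₚ.≤-trans (s≤s a≤n) (ℕₚ.m≤m+n N N))
  stabilizer-trivial (a , true) u a≤n fixed = ⊥-elim (ℕₚ.1+n≰n (subst (_≤ n) (cong ∣_∣ a≡-N) a≤n))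
    where
    bound : ∣ a ℤ.+ + N ∣ < L
    bound = s≤s (ℕₚ.≤-trans (ℤₚ.∣i+j∣≤∣i∣+∣j∣ a (+ N)) (ℕₚ.+-monoˡ-≤ N a≤n))
    a≡-N : a ≡ ℤ.- + N
    a≡-N = ℤₚ.i-j≡0⇒i≡j a (ℤ.- + N) (pow-fixed⇒≡0 (a ℤ.+ + N) u bound fixed)

cycle : ℕ → GSet
cycle n = record
  { Carrier    = Fin L
  ; _▷_        = _▷_
  ; ▷-identity = λ _ → refl
  ; ▷-assoc    = ▷-assoc
  ; _≟_        = Fin._≟_
  }
  where open Cycle n

upperBound : ∀ {n} (f : Fin n → ℕ) → ∃ λ b → ∀ i → f i < b
upperBound {zero}  f = 0 , λ ()
upperBound {suc n} f with upperBound (f ∘ suc)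
... | b , f∘suc<b = suc (f zero) + b , λ
  { zero    → s≤s (ℕₚ.m≤m+n (f zero) b)
  ; (suc i) → ℕₚ.≤-trans (f∘suc<b i) (ℕₚ.m≤n+m b (suc (f zero)))
  }

-- The first index numbers copies, so that every cycle occurs infinitely often.
cycles : GSet
cycles = ⨆ (ℕ × ℕ) (Product.≡-dec ℕₚ._≟_ ℕₚ._≟_) (cycle ∘ proj₂)

cycles⊎regular : GSet
cycles⊎regular = cycles ⊎ᴳ regular

open GSet cycles using () renaming (Carrier to C₁; _▷_ to _▷₁_)
open GSet cycles⊎regular using () renaming (Carrier to C₂; _▷_ to _▷₂_)

cycles-fixed-⇔ : ∀ {i} g u → (g ▷₁ (i , u) ≡ (i , u)) ⇔ (GSet._▷_ (cycle (proj₂ i)) g u ≡ u)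
cycles-fixed-⇔ = ⨆-fixed-⇔ (Product.≡-dec ℕₚ._≟_ ℕₚ._≟_) (cycle ∘ proj₂)

cycle-fixed-⇔ : ∀ {n} g u → ‖ g ‖ ≤ n → (GSet._▷_ (cycle n) g u ≡ u) ⇔ (g ≡ ε)
cycle-fixed-⇔ {n} g u g≤n = mk⇔ (Cycle.stabilizer-trivial n g u g≤n) (λ { refl → refl })

regular-fixed-⇔ : ∀ g h → (g · h ≡ h) ⇔ (g ≡ ε)
regular-fixed-⇔ g h = mk⇔ (·-fixed⇒ε g h) (λ { refl → ·-identityˡ h })

inj₁-≡-⇔ : ∀ {A B : Set} {a a′ : A} → (inj₁ {B = B} a ≡ inj₁ a′) ⇔ (a ≡ a′)
inj₁-≡-⇔ = mk⇔ Sum.inj₁-injective (cong inj₁)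

inj₂-≡-⇔ : ∀ {A B : Set} {b b′ : B} → (inj₂ {A = A} b ≡ inj₂ b′) ⇔ (b ≡ b′)
inj₂-≡-⇔ = mk⇔ Sum.inj₂-injective (cong inj₂)

unusedCopy₁ : ∀ {n} (β : Fin n → C₁) → ∃ λ b → ∀ {k u} i g → g ▷₁ β i ≢ ((b , k) , u)
unusedCopy₁ β with upperBound (proj₁ ∘ proj₁ ∘ β)
... | b , β<b = b , λ i g gβ≡ → ℕₚ.<⇒≢ (β<b i) (cong (proj₁ ∘ proj₁) gβ≡)

copy : C₂ → ℕ
copy (inj₁ ((c , _) , _)) = c
copy (inj₂ _)             = 0

copy-▷ : ∀ g z → copy (g ▷₂ z) ≡ copy z
copy-▷ g (inj₁ _) = refl
copy-▷ g (inj₂ _) = refl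

unusedCopy₂ : ∀ {n} (β : Fin n → C₂) → ∃ λ b → ∀ {k u} i g → g ▷₂ β i ≢ inj₁ ((b , k) , u)
unusedCopy₂ β with upperBound (copy ∘ β)
... | b , β<b = b , λ i g gβ≡ → ℕₚ.<⇒≢ (β<b i) (trans (sym (copy-▷ g (β i))) (cong copy gβ≡))

fresh₁₂ : Similarity.FreshPartners cycles cycles⊎regular
fresh₁₂ r ((_ , k) , u) β with unusedCopy₂ β
... | b , apart = inj₁ ((b , k) , u) , (λ i g _ → apart i g) , λ g _ →
  ⇔-trans (cycles-fixed-⇔ g u) (⇔-sym (⇔-trans inj₁-≡-⇔ (cycles-fixed-⇔ g u)))

fresh₂₁ : Similarity.FreshPartners cycles⊎regular cycles
fresh₂₁ r (inj₁ ((_ , k) , u)) β with unusedCopy₁ β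
... | b , apart = ((b , k) , u) , (λ i g _ → apart i g) , λ g _ →
  ⇔-trans inj₁-≡-⇔ (⇔-trans (cycles-fixed-⇔ g u) (⇔-sym (cycles-fixed-⇔ g u)))
fresh₂₁ r (inj₂ h) β with unusedCopy₁ β
... | b , apart = ((b , r) , zero) , (λ i g _ → apart i g) , λ g g≤r →
  ⇔-trans inj₂-≡-⇔ (⇔-trans (regular-fixed-⇔ g h)
    (⇔-sym (⇔-trans (cycles-fixed-⇔ g zero) (cycle-fixed-⇔ g zero g≤r))))

SC-cycles : ∀ x₀ → SC (RewriteSystem.𝔸 cycles x₀)
SC-cycles = m-reachable⇒SC reach
  where
  open RewriteSystem cycles
  reach : ∀ x → (base , x) ⟶* (base , m ▷₁ x)
  reach (i@(_ , k) , u) = subst (λ v → (base , (i , u)) ⟶* (base , (i , v)))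
    (sym (Cycle.m▷≡s^N▷ k u)) (⟶*-s-power (suc k) (i , u))

¬SC-cycles⊎regular : ∀ x₀ → ¬ SC (RewriteSystem.𝔸 cycles⊎regular x₀)
¬SC-cycles⊎regular = RewriteSystem.m∉s-orbit⇒¬SC cycles⊎regular (inj₂ ε) (λ a ())

x₁ : C₁
x₁ = (0 , 0) , zero

x₂ : C₂
x₂ = inj₂ ε

𝔸₁ 𝔸₂ : ARS
𝔸₁ = RewriteSystem.𝔸 cycles x₁
𝔸₂ = RewriteSystem.𝔸 cycles⊎regular x₂

same-sentences : ∀ φ → (𝔸₁ ⊨ φ) ⇔ (𝔸₂ ⊨ φ)
same-sentences = ElementaryEquivalence.⊨-invariant cycles cycles⊎regular fresh₁₂ fresh₂₁ x₁ x₂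

theorem3p19 : ¬ GenFO SC × ¬ GenFO (λ 𝒜 → ¬ SC 𝒜)
theorem3p19 =
    (λ SC-fo → ¬SC-cycles⊎regular x₂ (GenFO-transfer SC-fo 𝔸₁⇒𝔸₂ (SC-cycles x₁)))
  , (λ ¬SC-fo → GenFO-transfer ¬SC-fo 𝔸₂⇒𝔸₁ (¬SC-cycles⊎regular x₂) (SC-cycles x₁))
  where
  𝔸₁⇒𝔸₂ : ∀ φ → 𝔸₁ ⊨ φ → 𝔸₂ ⊨ φ
  𝔸₁⇒𝔸₂ = Equivalence.to ∘ same-sentences

  𝔸₂⇒𝔸₁ : ∀ φ → 𝔸₂ ⊨ φ → 𝔸₁ ⊨ φ
  𝔸₂⇒𝔸₁ = Equivalence.from ∘ same-sentences
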